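{- Let $\mathbf E$ be a finite reading event model. Every formula of $LD\preceq E$ derivable in the proof system $\mathbf{LD\preceq E}$ is valid on all epistemic models. In particular each reduction law is valid, e.g. for all $e\in E$, $B\subseteq A$ and formulas $\varphi$: $[e]D_B\varphi\leftrightarrow\bigwedge\{D_{\underline e(B)}[f]\varphi:f\in E,\ f\sim_Be\}$.
   Context: Fix a finite set $A$ of agents and atoms $Prop$. Epistemic model: $\mathbf S=(S,(\sim_a)_{a\in A},V)$, $\sim_a$ equivalence relations, $V:Prop\to\mathcal P(S)$, $\sim_B:=\bigcap_{b\in B}\sim_b$; $s\models D_B\varphi$ iff $t\models\varphi$ for all $t$ with $s\sim_Bt$; $s\models B\preceq C$ iff for all $t$, $s\sim_Bt$ implies $s\sim_Ct$. A reading event model is $\mathbf E=(E,(\sim_a)_{a\in A},\underline\bullet)$, $E$ finite, $\sim_a$ equivalence relations on $E$, each $e$ assigned $\underline e:A\to\mathcal P(A)$ with $a\in\underline e(a)$, and $e\sim_af$ implies $\underline e(a)=\underline f(a)$; $\underline e(B):=\bigcup_{b\in B}\underline e(b)$; $\sim_B:=\bigcap_{b\in B}\sim_b$ on $E$; $B\preceq^eC$ means: for all $f\in E$, $f\sim_Be$ implies $f\sim_Ce$. Product $\mathbf S\otimes\mathbf E$: states $S\times E$, $(s,e)\sim_a(s',e')$ iff $s\sim_{\underline e(a)}s'$ and $e\sim_ae'$, $(s,e)\in V(p)$ iff $s\in V(p)$; $s\models[e]\varphi$ iff $(s,e)\models_{\mathbf S\otimes\mathbf E}\varphi$. Language $LD\preceq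 E$: $\varphi::=p\mid\neg\varphi\mid\varphi\wedge\varphi\mid D_B\varphi\mid B\preceq C\mid[e]\varphi$. The system $\mathbf{LD\preceq E}$: classical propositional logic; for all $B,C,F\subseteq A$: from $\varphi$ infer $D_B\varphi$, $D_B(\varphi\to\psi)\to(D_B\varphi\to D_B\psi)$, $D_B\varphi\to\varphi$, $D_B\varphi\to D_BD_B\varphi$, $\neg D_B\varphi\to D_B\neg D_B\varphi$; $B\preceq C$ if $C\subseteq B$; $(B\preceq C\wedge B\preceq F)\to B\preceq C\cup F$; $(B\preceq C\wedge C\preceq F)\to B\preceq F$; $B\preceq C\to D_B(B\preceq C)$; $B\preceq C\to(D_C\varphi\to D_B\varphi)$; for each $e\in E$: from $\varphi$ infer $[e]\varphi$; $[e](\varphi\to\psi)\to([e]\varphi\to[e]\psi)$; $[e]p\leftrightarrow p$; $[e]\neg\varphi\leftrightarrow\neg[e]\varphi$; $[e](\varphi\wedge\psi)\leftrightarrow[e]\varphi\wedge[e]\psi$; $[e](B\preceq C)\leftrightarrow\underline e(B)\preceq\underline e(C)$ if $B\preceq^eC$; $[e](B\preceq C)\leftrightarrow\bot$ if not $B\preceq^eC$; $[e]D_B\varphi\leftrightarrow\bigwedge\{D_{\underline e(B)}[f]\varphi:f\sim_Be\}$. Valid means true at every state of every epistemic model. -}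

module Defs where

open import Level using (0ℓ)
open import Data.Nat using (ℕ)
open import Data.Fin using (Fin)
open import Data.Fin.Subset using (Subset; _∈_; _⊆_; _∪_; ⋃; ⊥)
open import Data.Fin.Subset.Properties using (_∈?_)
open import Data.Fin.Properties using (all?)
open import Data.List using (List; []; _∷_; map; filter; allFin)
open import Data.Product using (_×_; _,_)
open import Relation.Nullary using (¬_; Dec; yes; no)
open import Relation.Nullary.Decidable using (_→-dec_)
open import Relation.Binary.PropositionalEquality using (_≡_)
open import Relation.Binary.Structures using (IsEquivalence)

GroupRel : {n : ℕ} {X : Set} → (Fin n → X → X → Set) → Subset n → X → X → Set
GroupRel R B x y = ∀ b → b ∈ B → R b x y

record EventModel (n m : ℕ) : Set₁ where
  field
    _∼[_]_   : Fin m → Fin n → Fin m → Set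
    ∼-dec    : ∀ e a f → Dec (e ∼[ a ] f)
    ∼-equiv  : ∀ a → IsEquivalence (λ e f → e ∼[ a ] f)
    reads    : Fin m → Fin n → Subset n
    reads-self : ∀ e a → a ∈ reads e a
    reads-inv  : ∀ e f a → e ∼[ a ] f → reads e a ≡ reads f a

  rel : Fin n → Fin m → Fin m → Set
  rel a e f = e ∼[ a ] f

  _∼E[_]_ : Fin m → Subset n → Fin m → Set
  e ∼E[ B ] f = GroupRel rel B e f

  ∼E-dec : ∀ e B f → Dec (e ∼E[ B ] f)
  ∼E-dec e B f = all? (λ b → (b ∈? B) →-dec ∼-dec e b f)

  readsG : Fin m → Subset n → Subset n
  readsG e B = ⋃ (map (reads e) (filter (_∈? B) (allFin n)))

  Prec : Fin m → Subset n → Subset n → Set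
  Prec e B C = ∀ f → f ∼E[ B ] e → f ∼E[ C ] e

  related : Subset n → Fin m → List (Fin m)
  related B e = filter (λ f → ∼E-dec f B e) (allFin m)

infix 9 ¬'_
infixr 7 _∧'_
infix 9 [_]_
infix 8 _⪯_

data Form (n m : ℕ) (Prop : Set) : Set where
  atom : Prop → Form n m Prop
  ¬'_  : Form n m Prop → Form n m Prop
  _∧'_ : Form n m Prop → Form n m Prop → Form n m Prop
  D    : Subset n → Form n m Prop → Form n m Prop
  _⪯_  : Subset n → Subset n → Form n m Prop
  [_]_ : Fin m → Form n m Prop → Form n m Prop

module _ {n m : ℕ} {Prop : Set} where
  infixr 4 _→'_
  infix 3 _↔'_
  _→'_ : Form n m Prop → Form n m Prop → Form n m Prop
  φ →' ψ = ¬' (φ ∧' ¬' ψ)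

  _↔'_ : Form n m Prop → Form n m Prop → Form n m Prop
  φ ↔' ψ = (φ →' ψ) ∧' (ψ →' φ)

  ⊥' : Form n m Prop
  ⊥' = ¬' ((⊥ ⪯ ⊥) →' (⊥ ⪯ ⊥))

  ⊤' : Form n m Prop
  ⊤' = ¬' ⊥'

  ⋀ : List (Form n m Prop) → Form n m Prop
  ⋀ []       = ⊤'
  ⋀ (φ ∷ []) = φ
  ⋀ (φ ∷ φs) = φ ∧' ⋀ φs

-- Classical propositional tautologies: formulas true under every Boolean
-- valuation of formulas that respects ¬ and ∧ (all other formulas are
-- treated as propositional atoms).

open import Data.Bool using (Bool; true; not; _∧_)

Tautology : {n m : ℕ} {Prop : Set} → Form n m Prop → Set
Tautology {n} {m} {Prop} φ =
  (v : Form n m Prop → Bool) →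
  (∀ ψ → v (¬' ψ) ≡ not (v ψ)) →
  (∀ ψ χ → v (ψ ∧' χ) ≡ (v ψ ∧ v χ)) →
  v φ ≡ true

module System {n m : ℕ} {Prop : Set} (E : EventModel n m) where
  open EventModel E

  data ⊢_ : Form n m Prop → Set where
    taut : ∀ {φ} → Tautology φ → ⊢ φ
    mp   : ∀ {φ ψ} → ⊢ (φ →' ψ) → ⊢ φ → ⊢ ψ
    nec-D : ∀ {B φ} → ⊢ φ → ⊢ D B φ
    K-D   : ∀ {B φ ψ} → ⊢ (D B (φ →' ψ) →' (D B φ →' D B ψ))
    T-D   : ∀ {B φ} → ⊢ (D B φ →' φ)
    4-D   : ∀ {B φ} → ⊢ (D B φ →' D B (D B φ))
    5-D   : ∀ {B φ} → ⊢ (¬' D B φ →' D B (¬' D B φ))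
    ⪯-incl  : ∀ {B C} → C ⊆ B → ⊢ (B ⪯ C)
    ⪯-union : ∀ {B C F} → ⊢ (((B ⪯ C) ∧' (B ⪯ F)) →' (B ⪯ (C ∪ F)))
    ⪯-trans : ∀ {B C F} → ⊢ (((B ⪯ C) ∧' (C ⪯ F)) →' (B ⪯ F))
    ⪯-know  : ∀ {B C} → ⊢ ((B ⪯ C) →' D B (B ⪯ C))
    ⪯-D     : ∀ {B C φ} → ⊢ ((B ⪯ C) →' (D C φ →' D B φ))
    nec-E  : ∀ {e φ} → ⊢ φ → ⊢ ([ e ] φ)
    K-E    : ∀ {e φ ψ} → ⊢ ([ e ] (φ →' ψ) →' ([ e ] φ →' [ e ] ψ))
    red-atom : ∀ {e p} → ⊢ ([ e ] atom p ↔' atom p)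
    red-¬  : ∀ {e φ} → ⊢ ([ e ] (¬' φ) ↔' ¬' ([ e ] φ))
    red-∧  : ∀ {e φ ψ} → ⊢ ([ e ] (φ ∧' ψ) ↔' ([ e ] φ ∧' [ e ] ψ))
    red-⪯  : ∀ {e B C} → Prec e B C → ⊢ ([ e ] (B ⪯ C) ↔' (readsG e B ⪯ readsG e C))
    red-⪯⊥ : ∀ {e B C} → ¬ Prec e B C → ⊢ ([ e ] (B ⪯ C) ↔' ⊥')
    red-D  : ∀ {e B φ} →
      ⊢ ([ e ] D B φ ↔' ⋀ (map (λ f → D (readsG e B) ([ f ] φ)) (related B e)))

-- Structures (S, (∼_a), V) without the equivalence requirement; the truth
-- definition does not depend on it, and the product with an event model is
-- again such a structure.
record Structure (n : ℕ) (Prop : Set) : Set₁ where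
  field
    St  : Set
    R   : Fin n → St → St → Set
    Val : Prop → St → Set

record EpistemicModel (n : ℕ) (Prop : Set) : Set₁ where
  field
    str   : Structure n Prop
    equiv : ∀ a → IsEquivalence (Structure.R str a)

module Semantics {n m : ℕ} {Prop : Set} (E : EventModel n m) where
  open EventModel E

  _⊗E : Structure n Prop → Structure n Prop
  M ⊗E = record
    { St  = Structure.St M × Fin m
    ; R   = λ a → λ { (s , e) (s' , e') →
                GroupRel (Structure.R M) (reads e a) s s' × (e ∼[ a ] e') }
    ; Val = λ p → λ { (s , e) → Structure.Val M p s }
    }

  _,_⊨_ : (M : Structure n Prop) → Structure.St M → Form n m Prop → Set
  M , s ⊨ atom p   = Structure.Val M p s
  M , s ⊨ (¬' φ)   = ¬ (M , s ⊨ φ)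
  M , s ⊨ (φ ∧' ψ) = (M , s ⊨ φ) × (M , s ⊨ ψ)
  M , s ⊨ D B φ    = ∀ t → GroupRel (Structure.R M) B s t → M , t ⊨ φ
  M , s ⊨ (B ⪯ C)  = ∀ t → GroupRel (Structure.R M) B s t
                           → GroupRel (Structure.R M) C s t
  M , s ⊨ ([ e ] φ) = (M ⊗E) , (s , e) ⊨ φ

  Valid : Form n m Prop → Set₁
  Valid φ = (M : EpistemicModel n Prop) (s : Structure.St (EpistemicModel.str M)) →
            EpistemicModel.str M , s ⊨ φ

-- The S5 axioms hold because every ∼_B is an equivalence,
-- and the ⪯ axioms because B ⪯ C says ∼_B ⊆ ∼_C at the current state. The reduction laws
-- rest on one computation in the product: (s, e) ∼_B (t, f) iff s ∼_{e(B)} t and e ∼_B f,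
-- together with the fact that the product of an epistemic model with E is again epistemic,
-- so that necessitation for [e] can reuse the induction hypothesis there. Excluded middle
-- is needed because ¬' is interpreted by constructive negation.
module Submission where

open import Defs
open import Level using (0ℓ)
open import Data.Nat using (ℕ)
open import Axiom.ExcludedMiddle using (ExcludedMiddle)

open import Axiom.DoubleNegationElimination using (em⇒dne)
open import Data.Bool using (Bool; true; not; _∧_)
open import Data.Empty using (⊥-elim)
open import Data.Fin using (Fin)
open import Data.Fin.Subset using (Subset; _∈_; _∪_; ⋃)
open import Data.Fin.Subset.Properties using (_∈?_; ∉⊥; x∈p∪q⁻; x∈p∪q⁺)
open import Data.List using (List; []; _∷_; map; filter; allFin)
open import Data.List.Membership.Propositional using () renaming (_∈_ to _∈ₗ_)
open import Data.List.Membership.Propositional.Properties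
  using (∈-filter⁺; ∈-filter⁻; ∈-allFin; ∈-map⁺; ∈-map⁻)
open import Data.List.Relation.Unary.All as All using (All; []; _∷_)
open import Data.List.Relation.Unary.All.Properties as All using ()
open import Data.List.Relation.Unary.Any using (here; there)
open import Data.Product using (_×_; _,_; proj₁; proj₂; ∃)
open import Data.Sum using (inj₁; inj₂) renaming ([_,_] to either)
open import Relation.Nullary using (¬_; Dec; yes; no; does)
open import Relation.Nullary.Decidable using (does-≡; ¬?; _×-dec_)
open import Relation.Binary.PropositionalEquality using (_≡_; refl; subst)
open import Relation.Binary.Structures using (IsEquivalence)

x∈⋃⁻ : ∀ {k} {x : Fin k} (ps : List (Subset k)) → x ∈ ⋃ ps → ∃ λ p → p ∈ₗ ps × x ∈ p
x∈⋃⁻ []       x∈ = ⊥-elim (∉⊥ x∈)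
x∈⋃⁻ (p ∷ ps) x∈ with x∈p∪q⁻ p (⋃ ps) x∈
... | inj₁ x∈p  = p , here refl , x∈p
... | inj₂ x∈ps with x∈⋃⁻ ps x∈ps
...   | q , q∈ps , x∈q = q , there q∈ps , x∈q

x∈⋃⁺ : ∀ {k} {x : Fin k} {p} {ps : List (Subset k)} → p ∈ₗ ps → x ∈ p → x ∈ ⋃ ps
x∈⋃⁺               (here refl) x∈p = x∈p∪q⁺ (inj₁ x∈p)
x∈⋃⁺ {ps = q ∷ ps} (there p∈)  x∈p = x∈p∪q⁺ {p = q} (inj₂ (x∈⋃⁺ p∈ x∈p))

does≡true⇒ : ∀ {ℓ} {A : Set ℓ} (a? : Dec A) → does a? ≡ true → A
does≡true⇒ (yes a) _  = a
does≡true⇒ (no _)  ()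

GroupRel-isEquivalence : ∀ {k} {X : Set} {R : Fin k → X → X → Set} →
  (∀ a → IsEquivalence (R a)) → ∀ B → IsEquivalence (GroupRel R B)
GroupRel-isEquivalence equiv B = record
  { refl  = λ b _ → IsEquivalence.refl (equiv b)
  ; sym   = λ r b b∈ → IsEquivalence.sym (equiv b) (r b b∈)
  ; trans = λ r r′ b b∈ → IsEquivalence.trans (equiv b) (r b b∈) (r′ b b∈)
  }

module Product {n m : ℕ} (E : EventModel n m) where
  open EventModel E

  ∼E-isEquivalence : ∀ B → IsEquivalence (_∼E[ B ]_)
  ∼E-isEquivalence = GroupRel-isEquivalence ∼-equiv

  ∈-readsG⁻ : ∀ {x} e B → x ∈ readsG e B → ∃ λ b → b ∈ B × x ∈ reads e b
  ∈-readsG⁻ e B x∈ with x∈⋃⁻ (map (reads e) (filter (_∈? B) (allFin n))) x∈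
  ... | p , p∈ , x∈p with ∈-map⁻ (reads e) p∈
  ...   | b , b∈ , refl = b , proj₂ (∈-filter⁻ (_∈? B) {xs = allFin n} b∈) , x∈p

  ∈-readsG⁺ : ∀ {x b} e B → b ∈ B → x ∈ reads e b → x ∈ readsG e B
  ∈-readsG⁺ {b = b} e B b∈B =
    x∈⋃⁺ (∈-map⁺ (reads e) (∈-filter⁺ (_∈? B) (∈-allFin b) b∈B))

  ∈-related⁻ : ∀ {B e f} → f ∈ₗ related B e → f ∼E[ B ] e
  ∈-related⁻ {B} {e} f∈ = proj₂ (∈-filter⁻ (λ f → ∼E-dec f B e) {xs = allFin m} f∈)

  ∈-related⁺ : ∀ {B e f} → f ∼E[ B ] e → f ∈ₗ related B e
  ∈-related⁺ {B} {e} {f} = ∈-filter⁺ (λ f → ∼E-dec f B e) (∈-allFin f)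

  module _ {Prop : Set} where
    open Semantics {Prop = Prop} E

    module _ (S : Structure n Prop) where
      open Structure S

      ⊗-∼⁻ : ∀ {B s e t f} → GroupRel (Structure.R (S ⊗E)) B (s , e) (t , f) →
             GroupRel R (readsG e B) s t × e ∼E[ B ] f
      ⊗-∼⁻ {B} {e = e} r =
        (λ x x∈ → let b , b∈ , x∈′ = ∈-readsG⁻ e B x∈ in proj₁ (r b b∈) x x∈′) ,
        (λ b b∈ → proj₂ (r b b∈))

      ⊗-∼⁺ : ∀ {B s e t f} → GroupRel R (readsG e B) s t → e ∼E[ B ] f →
             GroupRel (Structure.R (S ⊗E)) B (s , e) (t , f)
      ⊗-∼⁺ {B} {e = e} r r′ b b∈ = (λ x x∈ → r x (∈-readsG⁺ e B b∈ x∈)) , r′ b b∈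

    _⊗EM : EpistemicModel n Prop → EpistemicModel n Prop
    M ⊗EM = record { str = str ⊗E ; equiv = ⊗-equiv }
      where
      open EpistemicModel M
      module ∼ a = IsEquivalence (equiv a)
      module ∼ᴱ a = IsEquivalence (∼-equiv a)
      -- reads-inv: the reading set of a is constant along ∼_a, which gives symmetry and transitivity.
      ⊗-equiv : ∀ a → IsEquivalence (Structure.R (str ⊗E) a)
      ⊗-equiv a = record
        { refl  = (λ b _ → ∼.refl b) , ∼ᴱ.refl a
        ; sym   = λ { {_ , e} {_ , f} (r , r′) →
            (λ b b∈ → ∼.sym b (r b (subst (b ∈_) (reads-inv f e a (∼ᴱ.sym a r′)) b∈))) , ∼ᴱ.sym a r′ }
        ; trans = λ { {_ , e} {_ , f} (r , r′) (q , q′) →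
            (λ b b∈ → ∼.trans b (r b b∈) (q b (subst (b ∈_) (reads-inv e f a r′) b∈))) ,
            ∼ᴱ.trans a r′ q′ }
        }

module Soundness (em : ExcludedMiddle 0ℓ) {n m : ℕ} {Prop : Set} (E : EventModel n m) where
  open EventModel E
  open Semantics {Prop = Prop} E
  open System {Prop = Prop} E
  open Product E

  module _ (S : Structure n Prop) where

    ⊨-→⁺ : ∀ {s} φ ψ → (S , s ⊨ φ → S , s ⊨ ψ) → S , s ⊨ (φ →' ψ)
    ⊨-→⁺ φ ψ f (a , ¬b) = ¬b (f a)

    ⊨-→⁻ : ∀ {s} φ ψ → S , s ⊨ (φ →' ψ) → S , s ⊨ φ → S , s ⊨ ψ
    ⊨-→⁻ φ ψ h a = em⇒dne em λ ¬b → h (a , ¬b)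

    ⊨-↔⁺ : ∀ {s} φ ψ → (S , s ⊨ φ → S , s ⊨ ψ) → (S , s ⊨ ψ → S , s ⊨ φ) → S , s ⊨ (φ ↔' ψ)
    ⊨-↔⁺ φ ψ f g = ⊨-→⁺ φ ψ f , ⊨-→⁺ ψ φ g

    ⊨-⊤' : ∀ {s} → S , s ⊨ ⊤'
    ⊨-⊤' h = h λ (a , ¬a) → ¬a a

    ⊨-⋀⁺ : ∀ {s ψs} → All (S , s ⊨_) ψs → S , s ⊨ ⋀ ψs
    ⊨-⋀⁺ []               = ⊨-⊤'
    ⊨-⋀⁺ (a ∷ [])         = a
    ⊨-⋀⁺ (a ∷ as@(_ ∷ _)) = a , ⊨-⋀⁺ as

    ⊨-⋀⁻ : ∀ {s} ψs → S , s ⊨ ⋀ ψs → All (S , s ⊨_) ψs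
    ⊨-⋀⁻ []           _       = []
    ⊨-⋀⁻ (_ ∷ [])     a       = a ∷ []
    ⊨-⋀⁻ (_ ∷ χ ∷ ψs) (a , as) = a ∷ ⊨-⋀⁻ (χ ∷ ψs) as

    -- Truth at s is a Boolean valuation respecting ¬' and ∧'.
    ⊨-Tautology : ∀ {s} φ → Tautology φ → S , s ⊨ φ
    ⊨-Tautology {s} φ tautology = does≡true⇒ em (tautology v v-¬' v-∧')
      where
      v : Form n m Prop → Bool
      v ψ = does (em {S , s ⊨ ψ})
      v-¬' : ∀ ψ → v (¬' ψ) ≡ not (v ψ)
      v-¬' ψ = does-≡ em (¬? em)
      v-∧' : ∀ ψ χ → v (ψ ∧' χ) ≡ (v ψ ∧ v χ)
      v-∧' ψ χ = does-≡ em (em ×-dec em)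

  module _ (M : EpistemicModel n Prop) where
    open EpistemicModel M
    open Structure str using (R)
    module ∼S B = IsEquivalence (GroupRel-isEquivalence equiv B)
    module ∼E B = IsEquivalence (∼E-isEquivalence B)

    ⊨-red-⪯ : ∀ {e B C} s → Prec e B C → str , s ⊨ ([ e ] (B ⪯ C) ↔' (readsG e B ⪯ readsG e C))
    ⊨-red-⪯ {e} {B} {C} s B⪯ᵉC = ⊨-↔⁺ str ([ e ] (B ⪯ C)) (readsG e B ⪯ readsG e C)
      (λ h t r → proj₁ (⊗-∼⁻ str (h (t , e) (⊗-∼⁺ str r (∼E.refl B)))))
      (λ h (t , f) r → let r , r′ = ⊗-∼⁻ str r in
        ⊗-∼⁺ str (h t r) (∼E.sym C (B⪯ᵉC f (∼E.sym B r′))))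

    -- Every f ∼_B e is reached from (s, e) through the reflexive loop s ∼_{e(B)} s.
    ⊨-red-⪯⊥ : ∀ {e B C} s → ¬ Prec e B C → str , s ⊨ ([ e ] (B ⪯ C) ↔' ⊥')
    ⊨-red-⪯⊥ {e} {B} {C} s ¬B⪯ᵉC = ⊨-↔⁺ str ([ e ] (B ⪯ C)) ⊥'
      (λ h → ⊥-elim (¬B⪯ᵉC λ f r → ∼E.sym C (proj₂ (⊗-∼⁻ str
        (h (s , f) (⊗-∼⁺ str (∼S.refl (readsG e B)) (∼E.sym B r)))))))
      (λ ⊨⊥' → ⊥-elim (⊨-⊤' str ⊨⊥'))

    ⊨-red-D : ∀ {e B φ} s →
      str , s ⊨ ([ e ] D B φ ↔' ⋀ (map (λ f → D (readsG e B) ([ f ] φ)) (related B e)))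
    ⊨-red-D {e} {B} {φ} s = ⊨-↔⁺ str ([ e ] D B φ) (⋀ (map knows (related B e)))
      (λ h → ⊨-⋀⁺ str (All.map⁺ (All.tabulate λ f∈ t r →
        h (t , _) (⊗-∼⁺ str r (∼E.sym B (∈-related⁻ f∈))))))
      (λ h (t , f) r → let r , r′ = ⊗-∼⁻ str r in
        All.lookup (All.map⁻ (⊨-⋀⁻ str (map knows (related B e)) h))
          (∈-related⁺ (∼E.sym B r′)) t r)
      where
      knows : Fin m → Form n m Prop
      knows f = D (readsG e B) ([ f ] φ)

  open EpistemicModel using (str)

  sound : ∀ {φ} → ⊢ φ → Valid φ
  sound (taut {φ} t)    M s = ⊨-Tautology (str M) φ t
  sound (mp {φ} {ψ} d d′) M s = ⊨-→⁻ (str M) φ ψ (sound d M s) (sound d′ M s)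
  sound (nec-D d)       M s = λ t _ → sound d M t
  sound (K-D {B} {φ} {ψ}) M s = ⊨-→⁺ (str M) (D B (φ →' ψ)) (D B φ →' D B ψ) λ h →
    ⊨-→⁺ (str M) (D B φ) (D B ψ) λ h′ t r → ⊨-→⁻ (str M) φ ψ (h t r) (h′ t r)
  sound (T-D {B} {φ})   M s = ⊨-→⁺ (str M) (D B φ) φ λ h → h s (∼S.refl M B)
  sound (4-D {B} {φ})   M s = ⊨-→⁺ (str M) (D B φ) (D B (D B φ)) λ h t r u r′ →
    h u (∼S.trans M B r r′)
  sound (5-D {B} {φ})   M s = ⊨-→⁺ (str M) (¬' D B φ) (D B (¬' D B φ)) λ ¬h t r h →
    ¬h λ u r′ → h u (∼S.trans M B (∼S.sym M B r) r′)
  sound (⪯-incl C⊆B)    M s = λ t r b b∈ → r b (C⊆B b∈)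
  sound (⪯-union {B} {C} {F}) M s = ⊨-→⁺ (str M) ((B ⪯ C) ∧' (B ⪯ F)) (B ⪯ (C ∪ F))
    λ (h , h′) t r b b∈ → either (h t r b) (h′ t r b) (x∈p∪q⁻ C F b∈)
  sound (⪯-trans {B} {C} {F}) M s = ⊨-→⁺ (str M) ((B ⪯ C) ∧' (C ⪯ F)) (B ⪯ F)
    λ (h , h′) t r → h′ t (h t r)
  sound (⪯-know {B} {C}) M s = ⊨-→⁺ (str M) (B ⪯ C) (D B (B ⪯ C)) λ h t r u r′ →
    ∼S.trans M C (∼S.sym M C (h t r)) (h u (∼S.trans M B r r′))
  sound (⪯-D {B} {C} {φ}) M s = ⊨-→⁺ (str M) (B ⪯ C) (D C φ →' D B φ) λ h →
    ⊨-→⁺ (str M) (D C φ) (D B φ) λ h′ t r → h′ t (h t r)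
  sound (nec-E {e} d)   M s = sound d (M ⊗EM) (s , e)
  sound (K-E {e} {φ} {ψ}) M s = ⊨-→⁺ (str M) ([ e ] (φ →' ψ)) ([ e ] φ →' [ e ] ψ) λ h →
    ⊨-→⁺ (str M) ([ e ] φ) ([ e ] ψ) (⊨-→⁻ (str M ⊗E) φ ψ h)
  sound (red-atom {e} {p})  M s = ⊨-↔⁺ (str M) ([ e ] atom p) (atom p) (λ h → h) (λ h → h)
  sound (red-¬ {e} {φ})     M s = ⊨-↔⁺ (str M) ([ e ] (¬' φ)) (¬' ([ e ] φ)) (λ h → h) (λ h → h)
  sound (red-∧ {e} {φ} {ψ}) M s =
    ⊨-↔⁺ (str M) ([ e ] (φ ∧' ψ)) ([ e ] φ ∧' [ e ] ψ) (λ h → h) (λ h → h)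
  sound (red-⪯ B⪯ᵉC)   M s = ⊨-red-⪯ M s B⪯ᵉC
  sound (red-⪯⊥ ¬B⪯ᵉC) M s = ⊨-red-⪯⊥ M s ¬B⪯ᵉC
  sound red-D          M s = ⊨-red-D M s

lemma6 : ExcludedMiddle 0ℓ → {n m : ℕ} {Prop : Set} (E : EventModel n m) (φ : Form n m Prop) →
    System.⊢_ E φ → Semantics.Valid E φ
lemma6 em E _ = Soundness.sound em E
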